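{- Let $\overline{\mathsf{M}}$ be a complemented HMS model. For any individual $i\in I$ and any $\omega\in\Omega$: $\Lambda_i(\omega)_{S_{\Pi_i(\omega)}}=\Pi_i(\omega)$.
   Context: Fix a non-empty set $\mathsf{At}$. A complemented HMS model $\langle I,\{S_\Phi\},(r^\Phi_\Psi),(\Lambda_i),(\Pi_i),v\rangle$: $I\ne\emptyset$; non-empty pairwise disjoint spaces $S_\Phi$ ($\Phi\subseteq\mathsf{At}$), ordered $S_{\Phi'}\succeq S_\Phi$ iff $\Phi\subseteq\Phi'$; $\Omega=\bigcup_\Phi S_\Phi$; surjections $r^\Phi_\Psi:S_\Phi\to S_\Psi$, $r^\Phi_\Phi=\mathrm{id}$, $r^\Phi_\Upsilon=r^\Psi_\Upsilon\circ r^\Phi_\Psi$; $\omega_\Psi=r^\Phi_\Psi(\omega)$; for $D\subseteq S_\Phi$, $D_\Psi=D_{S_\Psi}=r^\Phi_\Psi(D)$, $D^\uparrow=\bigcup_{\Phi\subseteq\Psi}(r^\Psi_\Phi)^{ -1}(D)$; events are sets $D^\uparrow$; $v$ maps atoms to events. $\Pi_i:\Omega\to2^\Omega\setminus\{\emptyset\}$: Confinement ($\omega\in S_\Phi\Rightarrow\Pi_i(\omega)\subseteq S_\Psi$ for some $\Psi\subseteq\Phi$; this space is denoted $S_{\Pi_i(\omega)}$), Generalized Reflexivity ($\omega\in\Pi_i(\omega)^\uparrow$), Stationarity ($\omega'\in\Pi_i(\omega)\Rightarrow\Pi_i(\omega')=\Pi_i(\omega)$), Projections Preserve Ignorance ($\omega\in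 S_\Phi$, $\Psi\subseteq\Phi\Rightarrow\Pi_i(\omega)^\uparrow\subseteq\Pi_i(\omega_\Psi)^\uparrow$), Projections Preserve Knowledge ($\Upsilon\subseteq\Psi\subseteq\Phi$, $\omega\in S_\Phi$, $\Pi_i(\omega)\subseteq S_\Psi\Rightarrow\Pi_i(\omega)_\Upsilon=\Pi_i(\omega_\Upsilon)$). $\Lambda_i:\Omega\to2^\Omega$: Reflexivity ($\omega\in\Lambda_i(\omega)$), Stationarity ($\omega'\in\Lambda_i(\omega)\Rightarrow\Lambda_i(\omega')=\Lambda_i(\omega)$), Projections Preserve Implicit Knowledge ($\omega\in S_\Phi$, $\Psi\subseteq\Phi\Rightarrow\Lambda_i(\omega)_\Psi=\Lambda_i(\omega_\Psi)$), Explicit Measurability ($\omega'\in\Lambda_i(\omega)\Rightarrow\Pi_i(\omega')=\Pi_i(\omega)$), Implicit Measurability ($\omega'\in\Pi_i(\omega)\Rightarrow\Lambda_i(\omega')=\Lambda_i(\omega)_{S_{\Pi_i(\omega)}}$). -}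

module Defs where

open import Level using (0ℓ)
open import Data.Product using (Σ; ∃; ∃-syntax; _×_; _,_)
open import Relation.Unary using (Pred; _⊆_; _≐_)
open import Relation.Binary.PropositionalEquality using (_≡_)

-- A subset Φ ⊆ At is a predicate on At; spaces S_Φ are compared
-- extensionally (Φ ≐ Ψ), so pointwise-equal predicates name the same space.
Sub : Set → Set₁
Sub At = Pred At 0ℓ

-- A complemented HMS model over the atoms At.
--   Ω      : the union of all state spaces
--   sp ω   : the (index of the) space containing ω, i.e. ω ∈ S_Φ iff sp ω ≐ Φ
--            (this makes the spaces pairwise disjoint automatically)
--   r ω Ψ  : the projection ω_Ψ = r^Φ_Ψ(ω) (meaningful when Ψ ⊆ sp ω)
--   ΠSp i ω: the index Ψ of the space S_{Π_i(ω)} given by Confinement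
record HMSModel (At : Set) : Set₁ where
  field
    at₀ : At
    I   : Set
    i₀  : I
    Ω   : Set
    sp  : Ω → Sub At
    S-nonempty : (Φ : Sub At) → ∃[ ω ] (sp ω ≐ Φ)
    r    : Ω → Sub At → Ω
    r-sp : ∀ ω Ψ → Ψ ⊆ sp ω → sp (r ω Ψ) ≐ Ψ
    r-resp : ∀ ω Ψ Ψ' → Ψ ≐ Ψ' → r ω Ψ ≡ r ω Ψ'
    r-id : ∀ ω Ψ → Ψ ≐ sp ω → r ω Ψ ≡ ω
    r-comp : ∀ ω Ψ Υ → Υ ⊆ Ψ → Ψ ⊆ sp ω → r (r ω Ψ) Υ ≡ r ω Υ
    r-surj : ∀ Φ Ψ ω' → Ψ ⊆ Φ → sp ω' ≐ Ψ →
             ∃[ ω ] (sp ω ≐ Φ × r ω Ψ ≡ ω')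

  InSpace : Pred Ω 0ℓ → Sub At → Set
  InSpace D Φ = ∀ ω → D ω → sp ω ≐ Φ

  proj : Pred Ω 0ℓ → Sub At → Pred Ω 0ℓ
  proj D Ψ ω' = ∃[ ω ] (D ω × Ψ ⊆ sp ω × r ω Ψ ≡ ω')

  -- D^↑ = ⋃_{Φ ⊆ Ψ} (r^Ψ_Φ)^{-1}(D)   (for D ⊆ S_Φ)
  up : Pred Ω 0ℓ → Pred Ω 0ℓ
  up D ω = ∃[ ω' ] (D ω' × sp ω' ⊆ sp ω × r ω (sp ω') ≡ ω')

  IsEvent : Pred Ω 0ℓ → Set₁
  IsEvent E = ∃[ Φ ] ∃[ D ] (InSpace D Φ × E ≐ up D)

  field
    v : At → Pred Ω 0ℓ
    v-event : ∀ p → IsEvent (v p)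

    Π : I → Ω → Pred Ω 0ℓ
    Λ : I → Ω → Pred Ω 0ℓ
    ΠSp : I → Ω → Sub At

    Π-nonempty : ∀ i ω → ∃[ ω' ] Π i ω ω'
    conf-sub   : ∀ i ω → ΠSp i ω ⊆ sp ω
    conf-space : ∀ i ω → InSpace (Π i ω) (ΠSp i ω)
    gen-refl : ∀ i ω → up (Π i ω) ω
    Π-stat : ∀ i ω ω' → Π i ω ω' → Π i ω' ≐ Π i ω
    -- Projections Preserve Ignorance
    ppi : ∀ i ω Ψ → Ψ ⊆ sp ω → up (Π i ω) ⊆ up (Π i (r ω Ψ))
    -- Projections Preserve Knowledge
    ppk : ∀ i ω Ψ Υ → Υ ⊆ Ψ → Ψ ⊆ sp ω → InSpace (Π i ω) Ψ →
          proj (Π i ω) Υ ≐ Π i (r ω Υ)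
    Λ-refl : ∀ i ω → Λ i ω ω
    Λ-stat : ∀ i ω ω' → Λ i ω ω' → Λ i ω' ≐ Λ i ω
    -- Projections Preserve Implicit Knowledge
    ppik : ∀ i ω Ψ → Ψ ⊆ sp ω → proj (Λ i ω) Ψ ≐ Λ i (r ω Ψ)
    expl-meas : ∀ i ω ω' → Λ i ω ω' → Π i ω' ≐ Π i ω
    impl-meas : ∀ i ω ω' → Π i ω ω' → Λ i ω' ≐ proj (Λ i ω) (ΠSp i ω)

module Submission where

open import Defs
open import Relation.Unary using (_⊆_; _≐_)
open import Relation.Unary.Properties using (≐-sym; ≐-trans)
open import Data.Product using (_,_; proj₁; proj₂)
open import Relation.Binary.PropositionalEquality using (_≡_; sym; trans; subst)

-- Every state of Λ_i(ω)_{S_{Π_i(ω)}} lies in Λ_i(ω') for a fixed ω' ∈ Π_i(ω) (Implicit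
-- Measurability), so Explicit Measurability and Stationarity give it the possibility set
-- Π_i(ω). Such a state lies in the space of Π_i(ω), and Generalized Reflexivity restricted
-- to a state of that very space is plain reflexivity. The converse inclusion is Implicit
-- Measurability together with Reflexivity of Λ_i.

module _ {At : Set} (M : HMSModel At) where
  open HMSModel M

  proj-inSpace : ∀ D Ψ → InSpace (proj D Ψ) Ψ
  proj-inSpace D Ψ x (z , _ , Ψ⊆spz , z↦x) = subst (λ t → sp t ≐ Ψ) z↦x (r-sp z Ψ Ψ⊆spz)

  up-inSpace⇒∈ : ∀ {D Φ x} → InSpace D Φ → sp x ≐ Φ → up D x → D x
  up-inSpace⇒∈ {D} {x = x} D⊆SΦ spx (y , Dy , _ , x↦y) = subst D y≡x Dy
    where
    spy≐spx : sp y ≐ sp x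
    spy≐spx = ≐-trans (D⊆SΦ y Dy) (≐-sym spx)

    y≡x : y ≡ x
    y≡x = trans (sym x↦y) (r-id x (sp y) spy≐spx)

  Π-refl-inSpace : ∀ i {x Φ} → InSpace (Π i x) Φ → sp x ≐ Φ → Π i x x
  Π-refl-inSpace i Πx⊆SΦ spx = up-inSpace⇒∈ Πx⊆SΦ spx (gen-refl i _)

  Π-const-on-projΛ : ∀ i ω {x} → proj (Λ i ω) (ΠSp i ω) x → Π i x ≐ Π i ω
  Π-const-on-projΛ i ω {x} x∈proj with Π-nonempty i ω
  ... | ω' , ω'∈Πω = ≐-trans (expl-meas i ω' x x∈Λω') (Π-stat i ω ω' ω'∈Πω)
    where
    x∈Λω' : Λ i ω' x
    x∈Λω' = proj₂ (impl-meas i ω ω' ω'∈Πω) x∈proj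

  projΛ⊆Π : ∀ i ω → proj (Λ i ω) (ΠSp i ω) ⊆ Π i ω
  projΛ⊆Π i ω {x} x∈proj = proj₁ Πx≐Πω (Π-refl-inSpace i Πx⊆SΠ spx)
    where
    Πx≐Πω : Π i x ≐ Π i ω
    Πx≐Πω = Π-const-on-projΛ i ω x∈proj

    Πx⊆SΠ : InSpace (Π i x) (ΠSp i ω)
    Πx⊆SΠ y y∈Πx = conf-space i ω y (proj₁ Πx≐Πω y∈Πx)

    spx : sp x ≐ ΠSp i ω
    spx = proj-inSpace (Λ i ω) (ΠSp i ω) x x∈proj

  Π⊆projΛ : ∀ i ω → Π i ω ⊆ proj (Λ i ω) (ΠSp i ω)
  Π⊆projΛ i ω {x} x∈Πω = proj₁ (impl-meas i ω x x∈Πω) (Λ-refl i x)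

lemma5 : (At : Set) (M : HMSModel At) → let open HMSModel M in
    (i : I) (ω : Ω) → proj (Λ i ω) (ΠSp i ω) ≐ Π i ω
lemma5 At M i ω = projΛ⊆Π M i ω , Π⊆projΛ M i ω
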